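{- Let $m,n,r,s$ be positive integers with $n>r+2$ and $m>r$. If $n-r$ is even, then $\mathrm{SG}(n^m,r^s)=0$ if $r+m$ is even and $=1$ if $r+m$ is odd. If $n-r$ is odd, then $\mathrm{SG}(n^m,r^s)=0$ if $m-r$ is odd and $m-r\ge3$; $\mathrm{SG}(n^m,r^s)=1$ if $m-r=1$ or if $m-r$ is even and $m-r\ge 4$; and $\mathrm{SG}(n^m,r^s)=2$ if $m-r=2$.
   Context: $(n^m,r^s)$ is the partition with $m$ parts equal to $n$ followed by $s$ parts equal to $r$. LCTR: from nonempty $\lambda=(\lambda_1,\dots,\lambda_k)$ one may move to $T(\lambda)=(\lambda_2,\dots,\lambda_k)$ or $L(\lambda)=(\lambda_1-1,\dots,\lambda_k-1)$ (nonpositive entries omitted); $()$ has no moves. $\mathrm{SG}(())=0$, $\mathrm{SG}(\lambda)=\mathrm{mex}\{\mathrm{SG}(L(\lambda)),\mathrm{SG}(T(\lambda))\}$ otherwise, with $\mathrm{mex}(B)$ the least nonnegative integer not in $B$. -}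

module Defs where

open import Data.Nat using (ℕ; zero; suc; _∸_; _≟_)
open import Data.List using (List; []; _∷_; _++_; replicate; map; filter; length)
open import Data.Nat.ListAction using (sum)
open import Data.List.Membership.DecPropositional (_≟_) using (_∈?_)
open import Relation.Nullary using (yes; no)
open import Relation.Nullary using (¬_)
open import Relation.Nullary.Decidable using (¬?)

-- A partition is a weakly decreasing list of positive naturals.
Partition : Set
Partition = List ℕ

pp : ℕ → ℕ → ℕ → ℕ → Partition
pp n m r s = replicate m n ++ replicate s r

T : Partition → Partition
T [] = []
T (_ ∷ xs) = xs

L : Partition → Partition
L xs = filter (λ x → ¬? (x ≟ 0)) (map (λ x → x ∸ 1) xs)

-- mex B: least nonnegative integer not in B.  Searching 0,1,…,length B
-- suffices since some value ≤ length B is always missing.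
mexFrom : ℕ → ℕ → List ℕ → ℕ
mexFrom k zero B = k
mexFrom k (suc b) B with k ∈? B
... | yes _ = mexFrom (suc k) b B
... | no _ = k

mex : List ℕ → ℕ
mex B = mexFrom 0 (length B) B

-- Sprague–Grundy value with fuel; fuel ≥ sum λ suffices since every move
-- on a nonempty partition of positive parts strictly decreases the sum.
sgFuel : ℕ → Partition → ℕ
sgFuel _ [] = 0
sgFuel zero (_ ∷ _) = 0
sgFuel (suc k) xs@(_ ∷ _) = mex (sgFuel k (L xs) ∷ sgFuel k (T xs) ∷ [])

SG : Partition → ℕ
SG xs = sgFuel (sum xs) xs

-- Fix the gap g = n − r ≥ 3 and s ≥ 1. Every position reachable from (n^m, r^s) is a rectangle or a
-- two-block position ((r′+g)^m′, r′^s) with the same g and s, where L lowers r′ and T lowers m′. For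
-- m′ ≥ 1 its Grundy value depends only on m′ − r′: when m′ ≥ r′ it is 0, 1, and then the value of the
-- rectangle g^(m′−r′); when m′ < r′ it is the same sequence for the gap of the conjugate position.
-- This guess satisfies the mex recursion in the interior and on the boundary, where a move reaches a
-- rectangle, so it is the Grundy value. All values involved are eventually 2-periodic, which reduces
-- every mex identity to a finite table checked by evaluation.

module Submission where

open import Defs
open import Data.Nat using (ℕ; _+_; _∸_; _<_; _≤_; _%_)
open import Relation.Binary.PropositionalEquality using (_≡_)
open import Data.Product using (_×_)

open import Data.Nat using (zero; suc; z≤n; s≤s; s≤s⁻¹; _≟_; _*_)
open import Data.Nat.Properties
  using (≤-refl; ≤-trans; <-≤-trans; n≮0; m≤n+m; m≤m+n; m≤n⇒m≤1+n; +-mono-≤; +-monoʳ-≤; n≤1+n;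
         +-comm; m+n≤o⇒m≤o∸n; m+[n∸m]≡n; <⇒≤)
open import Data.Nat.DivMod using ([m+kn]%n≡m%n)
open import Data.Nat.Solver using (module +-*-Solver)
open import Data.Nat.ListAction using (sum)
open import Data.List using ([]; _∷_; _++_; replicate; map; filter)
open import Data.List.Properties using (map-++; filter-++; ++-identityʳ)
open import Data.List.Relation.Unary.All using (All; _∷_)
open import Data.List.Relation.Unary.All.Properties using (all-filter; replicate⁺; ++⁺)
open import Data.Product using (_,_)
open import Data.Empty using (⊥-elim)
open import Relation.Nullary.Decidable using (¬?)
open import Relation.Binary.PropositionalEquality
  using (_≢_; refl; sym; trans; cong; cong₂; subst; subst₂; module ≡-Reasoning)

mex₂ : ℕ → ℕ → ℕ
mex₂ a b = mex (a ∷ b ∷ [])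

mex₂-comm : ∀ a b → mex₂ a b ≡ mex₂ b a
mex₂-comm 0             0             = refl
mex₂-comm 0             1             = refl
mex₂-comm 0             (suc (suc b)) = refl
mex₂-comm 1             0             = refl
mex₂-comm 1             1             = refl
mex₂-comm 1             (suc (suc b)) = refl
mex₂-comm (suc (suc a)) 0             = refl
mex₂-comm (suc (suc a)) 1             = refl
mex₂-comm (suc (suc a)) (suc (suc b)) = refl

Positive : Partition → Set
Positive = All (_≢ 0)

sum-L-≤ : ∀ xs → sum (L xs) ≤ sum xs
sum-L-≤ []                  = z≤n
sum-L-≤ (0 ∷ xs)            = sum-L-≤ xs
sum-L-≤ (1 ∷ xs)            = m≤n⇒m≤1+n (sum-L-≤ xs)
sum-L-≤ (suc (suc x) ∷ xs)  = +-mono-≤ (n≤1+n (suc x)) (sum-L-≤ xs)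

sum-L-< : ∀ {x} xs → x ≢ 0 → sum (L (x ∷ xs)) < sum (x ∷ xs)
sum-L-< {0}           xs x≢0 = ⊥-elim (x≢0 refl)
sum-L-< {1}           xs _   = s≤s (sum-L-≤ xs)
sum-L-< {suc (suc x)} xs _   = s≤s (s≤s (+-monoʳ-≤ x (sum-L-≤ xs)))

sum-tail-< : ∀ {x} xs → x ≢ 0 → sum xs < sum (x ∷ xs)
sum-tail-< {0}     xs x≢0 = ⊥-elim (x≢0 refl)
sum-tail-< {suc x} xs _   = s≤s (m≤n+m (sum xs) x)

L-positive : ∀ xs → Positive (L xs)
L-positive xs = all-filter (λ x → ¬? (x ≟ 0)) (map (_∸ 1) xs)

sgFuel-irrelevant : ∀ {j k} xs → Positive xs → sum xs ≤ j → sum xs ≤ k → sgFuel j xs ≡ sgFuel k xs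
sgFuel-irrelevant []       _ _ _ = refl
sgFuel-irrelevant {zero} (x ∷ xs) (x≢0 ∷ _) j-bound _ = ⊥-elim (n≮0 (<-≤-trans (sum-tail-< xs x≢0) j-bound))
sgFuel-irrelevant {suc _} {zero} (x ∷ xs) (x≢0 ∷ _) _ k-bound = ⊥-elim (n≮0 (<-≤-trans (sum-tail-< xs x≢0) k-bound))
sgFuel-irrelevant {suc _} {suc _} (x ∷ xs) (x≢0 ∷ xs⁺) j-bound k-bound =
  cong₂ mex₂
    (sgFuel-irrelevant (L (x ∷ xs)) (L-positive (x ∷ xs)) (below (sum-L-< xs x≢0) j-bound) (below (sum-L-< xs x≢0) k-bound))
    (sgFuel-irrelevant xs xs⁺ (below (sum-tail-< xs x≢0) j-bound) (below (sum-tail-< xs x≢0) k-bound))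
  where
  below : ∀ {a b c} → a < b → b ≤ suc c → a ≤ c
  below a<b b≤1+c = s≤s⁻¹ (≤-trans a<b b≤1+c)

SG-unfold : ∀ {x xs} → Positive (x ∷ xs) → SG (x ∷ xs) ≡ mex₂ (SG (L (x ∷ xs))) (SG xs)
SG-unfold {0}     (x≢0 ∷ _) = ⊥-elim (x≢0 refl)
SG-unfold {suc x} {xs} (x≢0 ∷ xs⁺) =
  cong₂ mex₂
    (sgFuel-irrelevant (L (suc x ∷ xs)) (L-positive (suc x ∷ xs)) (s≤s⁻¹ (sum-L-< xs x≢0)) ≤-refl)
    (sgFuel-irrelevant xs xs⁺ (m≤n+m (sum xs) x) ≤-refl)

SG-by-moves : ∀ {x xs ℓ t v} → Positive (x ∷ xs) →
              SG (L (x ∷ xs)) ≡ ℓ → SG xs ≡ t → mex₂ ℓ t ≡ v → SG (x ∷ xs) ≡ v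
SG-by-moves x∷xs⁺ eqL eqT eqv = trans (SG-unfold x∷xs⁺) (trans (cong₂ mex₂ eqL eqT) eqv)

L-++ : ∀ xs ys → L (xs ++ ys) ≡ L xs ++ L ys
L-++ xs ys = trans (cong (filter (λ x → ¬? (x ≟ 0))) (map-++ (_∸ 1) xs ys))
                   (filter-++ (λ x → ¬? (x ≟ 0)) (map (_∸ 1) xs) (map (_∸ 1) ys))

L-replicate : ∀ p a → L (replicate p (suc (suc a))) ≡ replicate p (suc a)
L-replicate zero    a = refl
L-replicate (suc p) a = cong (suc a ∷_) (L-replicate p a)

L-replicate-1 : ∀ p → L (replicate p 1) ≡ []
L-replicate-1 zero    = refl
L-replicate-1 (suc p) = L-replicate-1 p

L-pp : ∀ n m r s → L (pp (suc (suc n)) m (suc (suc r)) s) ≡ pp (suc n) m (suc r) s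
L-pp n m r s = trans (L-++ (replicate m (suc (suc n))) _) (cong₂ _++_ (L-replicate m n) (L-replicate s r))

L-pp-1 : ∀ n m s → L (pp (suc (suc n)) m 1 s) ≡ replicate m (suc n)
L-pp-1 n m s = trans (L-++ (replicate m (suc (suc n))) _)
                     (trans (cong₂ _++_ (L-replicate m n) (L-replicate-1 s)) (++-identityʳ _))

pp-positive : ∀ {n r} m s → n ≢ 0 → r ≢ 0 → Positive (pp n m r s)
pp-positive m s n≢0 r≢0 = ++⁺ (replicate⁺ m n≢0) (replicate⁺ s r≢0)

SG-pp-by-moves : ∀ n m r s {ℓ t v} → n ≢ 0 → r ≢ 0 →
                 SG (L (pp n (suc m) r s)) ≡ ℓ → SG (pp n m r s) ≡ t → mex₂ ℓ t ≡ v → SG (pp n (suc m) r s) ≡ v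
SG-pp-by-moves n m r s n≢0 r≢0 = SG-by-moves (pp-positive (suc m) s n≢0 r≢0)

rectSG : ℕ → ℕ → ℕ
rectSG _ zero = 0
rectSG zero (suc _) = 0
rectSG (suc (suc (suc (suc (suc a))))) p@(suc _) = rectSG (suc (suc (suc a))) p
rectSG 1 (suc (suc (suc p))) = rectSG 1 (suc p)
rectSG 1 1 = 1
rectSG 1 2 = 2
rectSG 2 (suc (suc (suc p))) = rectSG 2 (suc p)
rectSG 2 1 = 2
rectSG 2 2 = 0
rectSG 3 (suc (suc (suc (suc (suc p))))) = rectSG 3 (suc (suc (suc p)))
rectSG 3 1 = 1
rectSG 3 2 = 2
rectSG 3 3 = 0
rectSG 3 4 = 1
rectSG 4 (suc (suc (suc (suc (suc p))))) = rectSG 4 (suc (suc (suc p)))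
rectSG 4 1 = 2
rectSG 4 2 = 0
rectSG 4 3 = 1
rectSG 4 4 = 0

rectSG-step : ∀ a p → rectSG (suc a) (suc p) ≡ mex₂ (rectSG a (suc p)) (rectSG (suc a) p)
rectSG-step (suc (suc (suc (suc (suc a))))) zero    = rectSG-step (suc (suc (suc a))) zero
rectSG-step (suc (suc (suc (suc (suc a))))) (suc p) = rectSG-step (suc (suc (suc a))) (suc p)
rectSG-step 0 (suc (suc (suc (suc (suc p))))) = rectSG-step 0 (suc (suc (suc p)))
rectSG-step 0 0 = refl
rectSG-step 0 1 = refl
rectSG-step 0 2 = refl
rectSG-step 0 3 = refl
rectSG-step 0 4 = refl
rectSG-step 1 (suc (suc (suc (suc (suc p))))) = rectSG-step 1 (suc (suc (suc p)))
rectSG-step 1 0 = refl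
rectSG-step 1 1 = refl
rectSG-step 1 2 = refl
rectSG-step 1 3 = refl
rectSG-step 1 4 = refl
rectSG-step 2 (suc (suc (suc (suc (suc p))))) = rectSG-step 2 (suc (suc (suc p)))
rectSG-step 2 0 = refl
rectSG-step 2 1 = refl
rectSG-step 2 2 = refl
rectSG-step 2 3 = refl
rectSG-step 2 4 = refl
rectSG-step 3 (suc (suc (suc (suc (suc p))))) = rectSG-step 3 (suc (suc (suc p)))
rectSG-step 3 0 = refl
rectSG-step 3 1 = refl
rectSG-step 3 2 = refl
rectSG-step 3 3 = refl
rectSG-step 3 4 = refl
rectSG-step 4 (suc (suc (suc (suc (suc p))))) = rectSG-step 4 (suc (suc (suc p)))
rectSG-step 4 0 = refl
rectSG-step 4 1 = refl
rectSG-step 4 2 = refl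
rectSG-step 4 3 = refl
rectSG-step 4 4 = refl

rectSG-width-period : ∀ a p → rectSG a (5 + p) ≡ rectSG a (3 + p)
rectSG-width-period (suc (suc (suc (suc (suc a))))) p = rectSG-width-period (suc (suc (suc a))) p
rectSG-width-period 0 p = refl
rectSG-width-period 1 p = refl
rectSG-width-period 2 p = refl
rectSG-width-period 3 p = refl
rectSG-width-period 4 p = refl

rectSG-row-1 : ∀ p → rectSG 1 (suc p) ≡ suc (p % 2)
rectSG-row-1 (suc (suc p)) = rectSG-row-1 p
rectSG-row-1 0 = refl
rectSG-row-1 1 = refl

rectSG-column-1 : ∀ a → rectSG (suc a) 1 ≡ suc (a % 2)
rectSG-column-1 (suc (suc (suc (suc a)))) = rectSG-column-1 (suc (suc a))
rectSG-column-1 0 = refl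
rectSG-column-1 1 = refl
rectSG-column-1 2 = refl
rectSG-column-1 3 = refl

SG-replicate : ∀ a p → SG (replicate p (suc a)) ≡ rectSG (suc a) p
SG-replicate a       zero    = refl
SG-replicate zero    (suc p) =
  SG-by-moves (replicate⁺ (suc p) (λ ())) (cong SG (L-replicate-1 (suc p))) (SG-replicate 0 p) (sym (rectSG-step 0 p))
SG-replicate (suc a) (suc p) =
  SG-by-moves (replicate⁺ (suc p) (λ ())) (trans (cong SG (L-replicate (suc p) a)) (SG-replicate a (suc p)))
              (SG-replicate (suc a) p) (sym (rectSG-step (suc a) p))

excessSG : ℕ → ℕ → ℕ
excessSG G 0 = 0
excessSG G 1 = 1
excessSG G (suc (suc e)) = rectSG G (suc (suc e))

excessSG-step : ∀ d e → excessSG (3 + d) (suc e) ≡ mex₂ (excessSG (3 + d) (2 + e)) (excessSG (3 + d) e)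
excessSG-step (suc (suc d)) 0             = excessSG-step d 0
excessSG-step (suc (suc d)) 1             = excessSG-step d 1
excessSG-step (suc (suc d)) (suc (suc e)) = excessSG-step d (suc (suc e))
excessSG-step 0 (suc (suc (suc (suc (suc e))))) = excessSG-step 0 (suc (suc (suc e)))
excessSG-step 0 0 = refl
excessSG-step 0 1 = refl
excessSG-step 0 2 = refl
excessSG-step 0 3 = refl
excessSG-step 0 4 = refl
excessSG-step 1 (suc (suc (suc (suc (suc e))))) = excessSG-step 1 (suc (suc (suc e)))
excessSG-step 1 0 = refl
excessSG-step 1 1 = refl
excessSG-step 1 2 = refl
excessSG-step 1 3 = refl
excessSG-step 1 4 = refl

excessSG-gap-period : ∀ d e → excessSG (5 + d) e ≡ excessSG (3 + d) e
excessSG-gap-period d 0             = refl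
excessSG-gap-period d 1             = refl
excessSG-gap-period d (suc (suc e)) = refl

-- Conjugation swaps L and T and turns (n^m, r^s) into ((m+s)^r, m^(n−r)), a position of gap s in which
-- the deficit r − m becomes an excess; the small gaps 1 and 2 behave like an even gap.
conjugateGap : ℕ → ℕ
conjugateGap (suc (suc (suc s))) = suc (suc (suc s))
conjugateGap _                   = 4

deficitSG : ℕ → ℕ → ℕ
deficitSG s = excessSG (conjugateGap s)

deficitSG-step : ∀ s k → deficitSG s (suc k) ≡ mex₂ (deficitSG s k) (deficitSG s (2 + k))
deficitSG-step s k = trans (gap-step s) (mex₂-comm (deficitSG s (2 + k)) (deficitSG s k))
  where
  gap-step : ∀ t → deficitSG t (suc k) ≡ mex₂ (deficitSG t (2 + k)) (deficitSG t k)
  gap-step (suc (suc (suc t))) = excessSG-step t k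
  gap-step 0                   = excessSG-step 1 k
  gap-step 1                   = excessSG-step 1 k
  gap-step 2                   = excessSG-step 1 k

deficitSG-edge : ∀ s k → deficitSG (suc s) (suc k) ≡ mex₂ (deficitSG (suc s) k) (rectSG (2 + k) (suc s))
deficitSG-edge (suc (suc (suc (suc s)))) k = begin
  deficitSG (5 + s) (suc k)                         ≡⟨ excessSG-gap-period s (suc k) ⟩
  deficitSG (3 + s) (suc k)                         ≡⟨ deficitSG-edge (suc (suc s)) k ⟩
  mex₂ (deficitSG (3 + s) k) (rectSG (2 + k) (3 + s))
    ≡⟨ sym (cong₂ mex₂ (excessSG-gap-period s k) (rectSG-width-period (2 + k) s)) ⟩
  mex₂ (deficitSG (5 + s) k) (rectSG (2 + k) (5 + s)) ∎
  where open ≡-Reasoning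
deficitSG-edge 0 (suc (suc (suc (suc (suc k))))) = deficitSG-edge 0 (suc (suc (suc k)))
deficitSG-edge 0 0 = refl
deficitSG-edge 0 1 = refl
deficitSG-edge 0 2 = refl
deficitSG-edge 0 3 = refl
deficitSG-edge 0 4 = refl
deficitSG-edge 1 (suc (suc (suc (suc (suc k))))) = deficitSG-edge 1 (suc (suc (suc k)))
deficitSG-edge 1 0 = refl
deficitSG-edge 1 1 = refl
deficitSG-edge 1 2 = refl
deficitSG-edge 1 3 = refl
deficitSG-edge 1 4 = refl
deficitSG-edge 2 (suc (suc (suc (suc (suc k))))) = deficitSG-edge 2 (suc (suc (suc k)))
deficitSG-edge 2 0 = refl
deficitSG-edge 2 1 = refl
deficitSG-edge 2 2 = refl
deficitSG-edge 2 3 = refl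
deficitSG-edge 2 4 = refl
deficitSG-edge 3 (suc (suc (suc (suc (suc k))))) = deficitSG-edge 3 (suc (suc (suc k)))
deficitSG-edge 3 0 = refl
deficitSG-edge 3 1 = refl
deficitSG-edge 3 2 = refl
deficitSG-edge 3 3 = refl
deficitSG-edge 3 4 = refl

module _ (d s : ℕ) where

  private
    gap : ℕ
    gap = 3 + d

  twoBlockSG : ℕ → ℕ → ℕ
  twoBlockSG zero    m       = excessSG gap m
  twoBlockSG (suc b) zero    = deficitSG (suc s) (suc b)
  twoBlockSG (suc b) (suc m) = twoBlockSG b m

  twoBlockSG-edge : ∀ b → twoBlockSG b 0 ≡ deficitSG (suc s) b
  twoBlockSG-edge zero    = refl
  twoBlockSG-edge (suc b) = refl

  twoBlockSG-step : ∀ b m → twoBlockSG b m ≡ mex₂ (twoBlockSG b (suc m)) (twoBlockSG (suc b) m)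
  twoBlockSG-step zero    zero    = refl
  twoBlockSG-step zero    (suc m) = excessSG-step d m
  twoBlockSG-step (suc b) zero    =
    trans (deficitSG-step (suc s) b) (cong (λ v → mex₂ v (deficitSG (suc s) (2 + b))) (sym (twoBlockSG-edge b)))
  twoBlockSG-step (suc b) (suc m) = twoBlockSG-step b m

  twoBlockSG-diagonal : ∀ b e → twoBlockSG b (b + e) ≡ excessSG gap e
  twoBlockSG-diagonal zero    e = refl
  twoBlockSG-diagonal (suc b) e = twoBlockSG-diagonal b e

  -- The moves are computed on lists (L-move, T-move) before SG is applied: comparing SG-terms that agree
  -- only up to computation makes Agda unfold the fuelled recursion of SG, which is very slow here.
  SG-twoBlock : ∀ b m → SG (pp (suc b + gap) (suc m) (suc b) (suc s)) ≡ twoBlockSG b m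
  SG-twoBlock zero zero =
    SG-pp-by-moves (suc zero + gap) 0 (suc zero) (suc s) (λ ()) (λ ())
      (trans (cong SG L-move) (trans (SG-replicate (2 + d) 1) (rectSG-column-1 (2 + d))))
      (trans (cong SG T-move) (trans (SG-replicate zero (suc s)) (rectSG-row-1 s)))
      refl
    where
    L-move : L (pp (suc zero + gap) 1 (suc zero) (suc s)) ≡ replicate 1 (suc (2 + d))
    L-move = L-pp-1 (2 + d) 1 (suc s)
    T-move : pp (suc zero + gap) 0 (suc zero) (suc s) ≡ replicate (suc s) (suc zero)
    T-move = refl
  SG-twoBlock zero (suc m) =
    SG-pp-by-moves (suc zero + gap) (suc m) (suc zero) (suc s) (λ ()) (λ ())
      (trans (cong SG L-move) (SG-replicate (2 + d) (2 + m)))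
      (SG-twoBlock zero m)
      (sym (excessSG-step d m))
    where
    L-move : L (pp (suc zero + gap) (2 + m) (suc zero) (suc s)) ≡ replicate (2 + m) (suc (2 + d))
    L-move = L-pp-1 (2 + d) (2 + m) (suc s)
  SG-twoBlock (suc b) zero =
    SG-pp-by-moves (suc (suc b) + gap) 0 (suc (suc b)) (suc s) (λ ()) (λ ())
      (trans (cong SG L-move) (trans (SG-twoBlock b zero) (twoBlockSG-edge b)))
      (trans (cong SG T-move) (SG-replicate (suc b) (suc s)))
      (sym (deficitSG-edge s b))
    where
    L-move : L (pp (suc (suc b) + gap) 1 (suc (suc b)) (suc s)) ≡ pp (suc b + gap) 1 (suc b) (suc s)
    L-move = L-pp (b + gap) 1 b (suc s)
    T-move : pp (suc (suc b) + gap) 0 (suc (suc b)) (suc s) ≡ replicate (suc s) (suc (suc b))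
    T-move = refl
  SG-twoBlock (suc b) (suc m) =
    SG-pp-by-moves (suc (suc b) + gap) (suc m) (suc (suc b)) (suc s) (λ ()) (λ ())
      (trans (cong SG L-move) (SG-twoBlock b (suc m)))
      (SG-twoBlock (suc b) m)
      (sym (twoBlockSG-step b m))
    where
    L-move : L (pp (suc (suc b) + gap) (2 + m) (suc (suc b)) (suc s)) ≡ pp (suc b + gap) (2 + m) (suc b) (suc s)
    L-move = L-pp (b + gap) (2 + m) b (suc s)

SG-excess : ∀ {G} r e s → 3 ≤ G → 1 ≤ r → 1 ≤ s → SG (pp (r + G) (r + e) r s) ≡ excessSG G e
SG-excess (suc b) e (suc s) (s≤s (s≤s (s≤s {n = d} z≤n))) (s≤s z≤n) (s≤s z≤n) =
  trans (SG-twoBlock d s b (b + e)) (twoBlockSG-diagonal d s b e)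

excessSG-4 : ∀ e → excessSG 4 e ≡ e % 2
excessSG-4 (suc (suc (suc (suc (suc e))))) = excessSG-4 (suc (suc (suc e)))
excessSG-4 0 = refl
excessSG-4 1 = refl
excessSG-4 2 = refl
excessSG-4 3 = refl
excessSG-4 4 = refl

excessSG-3-odd : ∀ e → e % 2 ≡ 1 → 3 ≤ e → excessSG 3 e ≡ 0
excessSG-3-odd (suc (suc (suc (suc (suc e))))) odd _ = excessSG-3-odd (suc (suc (suc e))) odd (s≤s (s≤s (s≤s z≤n)))
excessSG-3-odd 1 _ (s≤s ())
excessSG-3-odd 3 _ _ = refl

excessSG-3-even : ∀ e → e % 2 ≡ 0 → 4 ≤ e → excessSG 3 e ≡ 1
excessSG-3-even (suc (suc (suc (suc (suc (suc e)))))) even _ = excessSG-3-even (suc (suc (suc (suc e)))) even (s≤s (s≤s (s≤s (s≤s z≤n))))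
excessSG-3-even 0 _ ()
excessSG-3-even 2 _ (s≤s (s≤s ()))
excessSG-3-even 4 _ _ = refl

excessSG-evenGap : ∀ {G} e → 3 ≤ G → G % 2 ≡ 0 → excessSG G e ≡ e % 2
excessSG-evenGap e (s≤s (s≤s (s≤s {n = 1} z≤n))) _ = excessSG-4 e
excessSG-evenGap e (s≤s (s≤s (s≤s {n = suc (suc d)} z≤n))) even =
  trans (excessSG-gap-period d e) (excessSG-evenGap e (s≤s (s≤s (s≤s z≤n))) even)

excessSG-oddGap : ∀ {G} e → 3 ≤ G → G % 2 ≡ 1 → excessSG G e ≡ excessSG 3 e
excessSG-oddGap e (s≤s (s≤s (s≤s {n = 0} z≤n))) _ = refl
excessSG-oddGap e (s≤s (s≤s (s≤s {n = suc (suc d)} z≤n))) odd =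
  trans (excessSG-gap-period d e) (excessSG-oddGap e (s≤s (s≤s (s≤s z≤n))) odd)

[r+m]%2≡[m∸r]%2 : ∀ {r m} → r ≤ m → (r + m) % 2 ≡ (m ∸ r) % 2
[r+m]%2≡[m∸r]%2 {r} {m} r≤m = trans (cong (_% 2) r+m≡) ([m+kn]%n≡m%n (m ∸ r) r 2)
  where
  open ≡-Reasoning
  open +-*-Solver
  r+m≡ : r + m ≡ m ∸ r + r * 2
  r+m≡ = begin
    r + m                 ≡⟨ cong (r +_) (sym (m+[n∸m]≡n r≤m)) ⟩
    r + (r + (m ∸ r))     ≡⟨ solve 2 (λ r x → r :+ (r :+ x) := x :+ r :* con 2) refl r (m ∸ r) ⟩
    m ∸ r + r * 2         ∎

lemma3p15 : (m n r s : ℕ) → 1 ≤ m → 1 ≤ n → 1 ≤ r → 1 ≤ s →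
    r + 2 < n → r < m →
    ((n ∸ r) % 2 ≡ 0 →
        ((r + m) % 2 ≡ 0 → SG (pp n m r s) ≡ 0) ×
        ((r + m) % 2 ≡ 1 → SG (pp n m r s) ≡ 1)) ×
    ((n ∸ r) % 2 ≡ 1 →
        ((m ∸ r) % 2 ≡ 1 → 3 ≤ m ∸ r → SG (pp n m r s) ≡ 0) ×
        (m ∸ r ≡ 1 → SG (pp n m r s) ≡ 1) ×
        ((m ∸ r) % 2 ≡ 0 → 4 ≤ m ∸ r → SG (pp n m r s) ≡ 1) ×
        (m ∸ r ≡ 2 → SG (pp n m r s) ≡ 2))
lemma3p15 m n r s _ _ 1≤r 1≤s r+2<n r<m =
  (λ even → by-parity even , by-parity even) ,
  (λ odd → (λ e-odd 3≤e → via-gap-3 odd (excessSG-3-odd (m ∸ r) e-odd 3≤e)) ,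
           (λ e≡1 → trans SG≡ (cong (excessSG (n ∸ r)) e≡1)) ,
           (λ e-even 4≤e → via-gap-3 odd (excessSG-3-even (m ∸ r) e-even 4≤e)) ,
           (λ e≡2 → via-gap-3 odd (cong (excessSG 3) e≡2)))
  where
  3≤gap : 3 ≤ n ∸ r
  3≤gap = m+n≤o⇒m≤o∸n 3 (subst (_≤ n) (cong suc (+-comm r 2)) r+2<n)

  SG≡ : SG (pp n m r s) ≡ excessSG (n ∸ r) (m ∸ r)
  SG≡ = subst₂ (λ n′ m′ → SG (pp n′ m′ r s) ≡ excessSG (n ∸ r) (m ∸ r))
               (m+[n∸m]≡n (≤-trans (m≤m+n r 2) (<⇒≤ r+2<n))) (m+[n∸m]≡n (<⇒≤ r<m))
               (SG-excess r (m ∸ r) s 3≤gap 1≤r 1≤s)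

  by-parity : ∀ {v} → (n ∸ r) % 2 ≡ 0 → (r + m) % 2 ≡ v → SG (pp n m r s) ≡ v
  by-parity even r+m≡v = trans SG≡ (trans (excessSG-evenGap (m ∸ r) 3≤gap even) (trans (sym ([r+m]%2≡[m∸r]%2 (<⇒≤ r<m))) r+m≡v))

  via-gap-3 : ∀ {v} → (n ∸ r) % 2 ≡ 1 → excessSG 3 (m ∸ r) ≡ v → SG (pp n m r s) ≡ v
  via-gap-3 odd eq = trans SG≡ (trans (excessSG-oddGap (m ∸ r) 3≤gap odd) eq)
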